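{- Let $a$ and $b$ be two cells on the left edge (column $0$) of an $n\times n$ board, with $a$ strictly above $b$, and fix a closed knight's tour on the board. Then at most $122$ of the cells in $C_{a,b}$ are clean with respect to $\mathrm{crown}(a,b)$.
   Context: Use coordinates in which a cell is a point $(x,y)$ with $x\in\{0,\dots,n-1\}$ its column (increasing to the right) and $y\in\{0,\dots,n-1\}$ its row (increasing upward); two cells are a knight move apart if their coordinates differ by $1$ in one coordinate and $2$ in the other. A closed knight's tour is a Hamiltonian cycle in the knight-move graph on the cells; a turn is a triple of cyclically consecutive cells of the tour that are not collinear (the turn is said to be at the middle cell). For a cell $c$ in column $0$, define the four directions $D_1=(1,2)$, $D_2=(2,1)$, $D_3=(2,-1)$, $D_4=(1,-2)$, and let $r_i(c)$ be the ray starting at $c$ in direction $D_i$. For the cells $a$ above $b$ in column $0$ and rays $r$ from $a$ and $r'$ from $b$ that intersect, let $S(r,r')$ be the set of cells of the board lying on or below $r$ and on or above $r'$ (the bounded region between the two rays and the left edge). Define $\mathrm{crown}(a,b)=S(r_2(a),r_1(b))\cup S(r_3(a),r_2(b))\cup S(r_4(a),r_3(b))$. Let $C_{a,b}$ be the set of cells in column $0$ between $a$ and $b$, inclusive. For an edge cell $c$, its two legs are the two maximal sequences of consecutive tour moves in a straight line (without turns) having $c$ as an endpoint; a leg begins at $c$ and ends at its other endpoint. A cell $c\in C_{a,b}$ is clean (with respect to $\mathrm{crown}(a,b)$) if both of its legs end at cells outside $\mathrm{crown}(a,b)$. -}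

module Defs where

open import Data.Nat as ℕ using (ℕ)
open import Data.Integer using (ℤ; +_; -[1+_]; _+_; _-_; _*_; _≤_; _<_; ∣_∣)
open import Data.Product using (_×_; _,_; proj₁; proj₂; ∃)
open import Data.Sum using (_⊎_)
open import Relation.Binary.PropositionalEquality using (_≡_)
open import Relation.Nullary using (¬_)

-- A cell (x , y): x = column (rightwards), y = row (upwards).
Cell : Set
Cell = ℤ × ℤ

OnBoard : ℕ → Cell → Set
OnBoard n (x , y) = (+ 0 ≤ x × x < + n) × (+ 0 ≤ y × y < + n)

KnightMove : Cell → Cell → Set
KnightMove (x , y) (x' , y') =
  (∣ x' - x ∣ ≡ 1 × ∣ y' - y ∣ ≡ 2) ⊎ (∣ x' - x ∣ ≡ 2 × ∣ y' - y ∣ ≡ 1)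

-- A closed knight's tour (Hamiltonian cycle of the knight graph on the
-- n × n board), presented as a cyclic sequence of cells: an ℤ-indexed
-- sequence with period n*n which enumerates every board cell exactly once
-- per period, consecutive cells (including the wrap-around) a knight move apart.
record ClosedTour (n : ℕ) : Set where
  field
    cell     : ℤ → Cell
    onBoard  : ∀ i → OnBoard n (cell i)
    periodic : ∀ i → cell (i + + (n ℕ.* n)) ≡ cell i
    inj      : ∀ i j → + 0 ≤ i → i < + (n ℕ.* n) → + 0 ≤ j → j < + (n ℕ.* n) →
               cell i ≡ cell j → i ≡ j
    surj     : ∀ p → OnBoard n p → ∃ λ i → cell i ≡ p
    knight   : ∀ i → KnightMove (cell i) (cell (i + + 1))

Collinear : Cell → Cell → Cell → Set
Collinear (px , py) (qx , qy) (rx , ry) =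
  (qx - px) * (ry - qy) ≡ (qy - py) * (rx - qx)

TurnAt : ∀ {n} → ClosedTour n → ℤ → Set
TurnAt T j = ¬ Collinear (cell (j - + 1)) (cell j) (cell (j + + 1))
  where open ClosedTour T

D₁ D₂ D₃ D₄ : ℤ × ℤ
D₁ = (+ 1 , + 2)
D₂ = (+ 2 , + 1)
D₃ = (+ 2 , -[1+ 0 ])
D₄ = (+ 1 , -[1+ 1 ])

-- For the ray from (0 , y₀) in direction (dx , dy) (dx > 0), a point (x , y)
-- with x ≥ 0 lies on or below the ray iff dx*(y - y₀) ≤ dy*x.
OnOrBelow : ℤ → ℤ × ℤ → Cell → Set
OnOrBelow y₀ (dx , dy) (x , y) = dx * (y - y₀) ≤ dy * x

OnOrAbove : ℤ → ℤ × ℤ → Cell → Set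
OnOrAbove y₀ (dx , dy) (x , y) = dy * x ≤ dx * (y - y₀)

-- S(r , r') for r = ray from a = (0, ya) in direction D,
-- r' = ray from b = (0, yb) in direction D'  (cells with x ≥ 0)
InS : ℤ → ℤ × ℤ → ℤ → ℤ × ℤ → Cell → Set
InS ya D yb D' p = + 0 ≤ proj₁ p × OnOrBelow ya D p × OnOrAbove yb D' p

InCrown : ℕ → ℤ → ℤ → Cell → Set
InCrown n ya yb p =
  OnBoard n p ×
  (InS ya D₂ yb D₁ p ⊎ InS ya D₃ yb D₂ p ⊎ InS ya D₄ yb D₃ p)

-- Forward leg from tour position i ends at position i + k:
-- k ≥ 1, no turn strictly between, a turn at i + k.
ForwardLegEnd : ∀ {n} → ClosedTour n → ℤ → ℕ → Set
ForwardLegEnd T i k =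
  1 ℕ.≤ k × (∀ j → 1 ℕ.≤ j → j ℕ.< k → ¬ TurnAt T (i + + j)) × TurnAt T (i + + k)

BackwardLegEnd : ∀ {n} → ClosedTour n → ℤ → ℕ → Set
BackwardLegEnd T i k =
  1 ℕ.≤ k × (∀ j → 1 ℕ.≤ j → j ℕ.< k → ¬ TurnAt T (i - + j)) × TurnAt T (i - + k)

Clean : ∀ {n} → ClosedTour n → ℤ → ℤ → Cell → Set
Clean {n} T ya yb c =
  ∀ i → cell i ≡ c →
    (∀ k → ForwardLegEnd T i k → ¬ InCrown n ya yb (cell (i + + k))) ×
    (∀ k → BackwardLegEnd T i k → ¬ InCrown n ya yb (cell (i - + k)))
  where open ClosedTour T

-- A clean cell c = (0 , y) of C_{a,b} is left by the tour in two different directions among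
-- D₁, …, D₄: the neighbours of c lie to its right, and equal directions would make the tour
-- return after two steps.  A leg of c cannot turn at a cell of the crown, since it would then end
-- inside the crown; so both legs run straight as long as their rays stay in the crown, and the
-- tour passes straight through every crown cell of the two rays.  Call the pair of directions the
-- type of c.  For each of the six types τ there is a spacing s(τ) ≤ 5 such that, for clean cells
-- of type τ in rows y < y′ with s(τ) ∣ y′ − y, the ray of the lower cell in the more upward
-- direction of τ meets the ray of the upper cell in the other direction at a crown cell.  The
-- tour would pass straight through that cell in two directions, which is impossible since it
-- visits every cell once.  Hence a clean cell is determined by its type and its row modulo s(τ),
-- and there are at most 6 · 5 = 30 ≤ 122 of them.

module Submission where

open import Defs
open import Data.Nat using (ℕ)
open import Data.Integer using (ℤ; +_; _≤_; _<_)
open import Data.Product using (_×_; _,_)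
open import Data.List using (List; length)
open import Data.List.Relation.Unary.All using (All)
open import Data.List.Relation.Unary.Unique.Propositional using (Unique)
import Data.Nat as ℕ

open import Algebra.Bundles using (AbelianGroup)
open import Data.Empty using (⊥; ⊥-elim)
open import Data.Fin as Fin using (Fin; #_; combine; fromℕ<; toℕ)
import Data.Fin.Properties as FinP
open import Data.Integer as ℤ using (-[1+_]; _+_; _-_; _*_; -_; ∣_∣; +≤+; +<+)
open import Data.Integer.DivMod using (_%ℕ_; _/ℕ_; a≡a%ℕn+[a/ℕn]*n; n%ℕd<d)
import Data.Integer.Properties as ℤP
open import Data.Integer.Tactic.RingSolver using (solve-∀; solve)
open import Data.List using (lookup; _∷_; [])
open import Data.List.Membership.Propositional.Properties using (∈-lookup)
import Data.List.Relation.Unary.All as All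
open import Data.List.Relation.Unary.AllPairs using (_∷_)
open import Data.Nat using (zero; suc; z≤n; s≤s)
import Data.Nat.Properties as ℕP
open import Data.Product using (proj₁; proj₂; ∃)
open import Data.Sum using (_⊎_; inj₁; inj₂)
open import Data.Vec as Vec using (Vec)
open import Relation.Binary.Definitions using (tri<; tri≈; tri>)
open import Relation.Binary.PropositionalEquality
  using (_≡_; _≢_; refl; sym; trans; cong; cong₂; subst; subst₂; module ≡-Reasoning)
open import Relation.Nullary using (¬_; Dec; yes; no)

open import Algebra.Properties.Group (AbelianGroup.group ℤP.+-0-abelianGroup)
  using (∙-cancelˡ)

[i+j]-i≡j : ∀ i j → (i + j) - i ≡ j
[i+j]-i≡j = solve-∀

∣i∣≡n⇒i≡±n : ∀ i {n} → ∣ i ∣ ≡ n → i ≡ + n ⊎ i ≡ - + n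
∣i∣≡n⇒i≡±n (+ m)    refl = inj₁ refl
∣i∣≡n⇒i≡±n -[1+ m ] refl = inj₂ refl

≡-mod⇒≡+multiple : ∀ m .{{_ : ℕ.NonZero m}} i j → i %ℕ m ≡ j %ℕ m →
                    j ≡ i + (j /ℕ m - i /ℕ m) * + m
≡-mod⇒≡+multiple m i j i%m≡j%m = begin
  j                                        ≡⟨ a≡a%ℕn+[a/ℕn]*n j m ⟩
  + (j %ℕ m) + qj * + m                    ≡⟨ cong (λ r → + r + qj * + m) (sym i%m≡j%m) ⟩
  + (i %ℕ m) + qj * + m                    ≡⟨ regroup (+ (i %ℕ m)) qi qj (+ m) ⟩
  + (i %ℕ m) + qi * + m + (qj - qi) * + m  ≡⟨ cong (_+ (qj - qi) * + m) (sym (a≡a%ℕn+[a/ℕn]*n i m)) ⟩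
  i + (qj - qi) * + m                      ∎
  where
  open ≡-Reasoning
  qi qj : ℤ
  qi = i /ℕ m
  qj = j /ℕ m
  regroup : ∀ r q q′ w → r + q′ * w ≡ r + q * w + (q′ - q) * w
  regroup = solve-∀

i<i+j⇒0<j : ∀ i j → i < i + j → + 0 < j
i<i+j⇒0<j i j i<i+j = subst₂ _<_ (ℤP.+-inverseˡ i) (cancel i j) (ℤP.+-monoʳ-< (- i) i<i+j)
  where
  cancel : ∀ i j → - i + (i + j) ≡ j
  cancel = solve-∀

0≤-scaled : ∀ a {i} → + 0 ≤ i → + 0 ≤ + a * i
0≤-scaled a {i} 0≤i = subst (_≤ + a * i) (ℤP.*-zeroʳ (+ a)) (ℤP.*-monoˡ-≤-nonNeg (+ a) 0≤i)

≤-byGap : ∀ a {i j k l} → k ≤ l → j - i ≡ + a * (l - k) → i ≤ j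
≤-byGap a k≤l j-i≡ = ℤP.0≤i-j⇒j≤i (subst (+ 0 ≤_) (sym j-i≡) (0≤-scaled a (ℤP.i≤j⇒0≤j-i k≤l)))

≤-byGap₂ : ∀ a b {i j k l σ} → k ≤ l → + 0 ≤ σ → j - i ≡ + a * (l - k) + + b * σ → i ≤ j
≤-byGap₂ a b k≤l 0≤σ j-i≡ = ℤP.0≤i-j⇒j≤i
  (subst (+ 0 ≤_) (sym j-i≡) (ℤP.+-mono-≤ (0≤-scaled a (ℤP.i≤j⇒0≤j-i k≤l)) (0≤-scaled b 0≤σ)))

Unique⇒lookup-injective : ∀ {A : Set} {xs : List A} → Unique xs →
                          ∀ i j → lookup xs i ≡ lookup xs j → i ≡ j
Unique⇒lookup-injective (_ ∷ _)  Fin.zero    Fin.zero    _  = refl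
Unique⇒lookup-injective (x∉ ∷ _) Fin.zero    (Fin.suc j) eq =
  ⊥-elim (All.lookup x∉ (∈-lookup j) eq)
Unique⇒lookup-injective (x∉ ∷ _) (Fin.suc i) Fin.zero    eq =
  ⊥-elim (All.lookup x∉ (∈-lookup i) (sym eq))
Unique⇒lookup-injective (_ ∷ u)  (Fin.suc i) (Fin.suc j) eq =
  cong Fin.suc (Unique⇒lookup-injective u i j eq)

length≤-byInjectiveCode : ∀ {A : Set} {P : A → Set} {xs : List A} m (code : ∀ {x} → P x → Fin m) →
                          (∀ {x x′} (p : P x) (p′ : P x′) → code p ≡ code p′ → x ≡ x′) →
                          Unique xs → All P xs → length xs ℕ.≤ m
length≤-byInjectiveCode {xs = xs} m code code-injective unique all with length xs ℕ.≤? m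
... | yes ≤m = ≤m
... | no ≰m with FinP.pigeonhole (ℕP.≰⇒> ≰m) (λ i → code (All.lookup all (∈-lookup i)))
...   | i , j , i<j , same-code =
  ⊥-elim (FinP.<-irrefl (Unique⇒lookup-injective unique i j (code-injective _ _ same-code)) i<j)

-- Cells, knight moves and collinearity

infixl 6 _⊕_ _⊖_

_⊕_ : Cell → ℤ × ℤ → Cell
(x , y) ⊕ (a , b) = (x + a , y + b)

negate : ℤ × ℤ → ℤ × ℤ
negate (a , b) = (- a , - b)

_⊖_ : Cell → ℤ × ℤ → Cell
p ⊖ v = p ⊕ negate v

⊕-cancelˡ : ∀ p {v w} → p ⊕ v ≡ p ⊕ w → v ≡ w
⊕-cancelˡ (x , y) eq = cong₂ _,_ (∙-cancelˡ x _ _ (cong proj₁ eq)) (∙-cancelˡ y _ _ (cong proj₂ eq))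

⊕-⊖-cancel : ∀ p v → p ⊕ v ⊖ v ≡ p
⊕-⊖-cancel (x , y) (a , b) = cong₂ _,_ (cancel x a) (cancel y b)
  where
  cancel : ∀ i j → i + j - j ≡ i
  cancel = solve-∀

⊖-⊕-cancel : ∀ p v → p ⊖ v ⊕ v ≡ p
⊖-⊕-cancel (x , y) (a , b) = cong₂ _,_ (cancel x a) (cancel y b)
  where
  cancel : ∀ i j → i - j + j ≡ i
  cancel = solve-∀

Δ⇒⊕ : ∀ {px py qx qy a b} → qx - px ≡ a → qy - py ≡ b → (qx , qy) ≡ (px , py) ⊕ (a , b)
Δ⇒⊕ {px} {py} {qx} {qy} refl refl = cong₂ _,_ (i≡j+[i-j] qx px) (i≡j+[i-j] qy py)
  where
  i≡j+[i-j] : ∀ i j → i ≡ j + (i - j)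
  i≡j+[i-j] = solve-∀

Along : ℤ × ℤ → Cell → Cell → Set
Along v p q = q ≡ p ⊕ v ⊎ q ≡ p ⊖ v

Along-sym : ∀ {v p q} → Along v p q → Along v q p
Along-sym {v} {p} (inj₁ refl) = inj₂ (sym (⊕-⊖-cancel p v))
Along-sym {v} {p} (inj₂ refl) = inj₁ (sym (⊖-⊕-cancel p v))

data Dir : Set where
  d₁ d₂ d₃ d₄ : Dir

vec : Dir → ℤ × ℤ
vec d₁ = D₁
vec d₂ = D₂
vec d₃ = D₃
vec d₄ = D₄

KnightAdjacent : Cell → Cell → Set
KnightAdjacent p q = ∃ λ e → Along (vec e) p q

KnightAdjacent-sym : ∀ {p q} → KnightAdjacent p q → KnightAdjacent q p
KnightAdjacent-sym (e , along) = e , Along-sym along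

knightMove⇒adjacent : ∀ p q → KnightMove p q → KnightAdjacent p q
knightMove⇒adjacent (px , py) (qx , qy) (inj₁ (∣Δx∣≡1 , ∣Δy∣≡2))
  with ∣i∣≡n⇒i≡±n (qx - px) ∣Δx∣≡1 | ∣i∣≡n⇒i≡±n (qy - py) ∣Δy∣≡2
... | inj₁ Δx | inj₁ Δy = d₁ , inj₁ (Δ⇒⊕ Δx Δy)
... | inj₁ Δx | inj₂ Δy = d₄ , inj₁ (Δ⇒⊕ Δx Δy)
... | inj₂ Δx | inj₁ Δy = d₄ , inj₂ (Δ⇒⊕ Δx Δy)
... | inj₂ Δx | inj₂ Δy = d₁ , inj₂ (Δ⇒⊕ Δx Δy)
knightMove⇒adjacent (px , py) (qx , qy) (inj₂ (∣Δx∣≡2 , ∣Δy∣≡1))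
  with ∣i∣≡n⇒i≡±n (qx - px) ∣Δx∣≡2 | ∣i∣≡n⇒i≡±n (qy - py) ∣Δy∣≡1
... | inj₁ Δx | inj₁ Δy = d₂ , inj₁ (Δ⇒⊕ Δx Δy)
... | inj₁ Δx | inj₂ Δy = d₃ , inj₁ (Δ⇒⊕ Δx Δy)
... | inj₂ Δx | inj₁ Δy = d₃ , inj₂ (Δ⇒⊕ Δx Δy)
... | inj₂ Δx | inj₂ Δy = d₂ , inj₂ (Δ⇒⊕ Δx Δy)

leftward-x<0 : ∀ d y → ¬ (+ 0 ≤ proj₁ ((+ 0 , y) ⊖ vec d))
leftward-x<0 d₁ y ()
leftward-x<0 d₂ y ()
leftward-x<0 d₃ y ()
leftward-x<0 d₄ y ()

rightward-move : ∀ y q → KnightAdjacent (+ 0 , y) q → + 0 ≤ proj₁ q → ∃ λ d → q ≡ (+ 0 , y) ⊕ vec d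
rightward-move y q adjacent 0≤x with adjacent
... | d , inj₁ q≡ = d , q≡
... | d , inj₂ refl = ⊥-elim (leftward-x<0 d y 0≤x)

Parallel : ℤ × ℤ → ℤ × ℤ → Set
Parallel (a , b) (c , e) = a * e ≡ b * c

Parallel-negate : ∀ u w → Parallel u (negate w) → Parallel u w
Parallel-negate (a , b) (c , e) h = ℤP.neg-injective
  (trans (ℤP.neg-distribʳ-* a e) (trans h (sym (ℤP.neg-distribʳ-* b c))))

parallel-vec⇒≡ : ∀ d e → Parallel (vec d) (vec e) → d ≡ e
parallel-vec⇒≡ d₁ d₁ _ = refl
parallel-vec⇒≡ d₁ d₂ ()
parallel-vec⇒≡ d₁ d₃ ()
parallel-vec⇒≡ d₁ d₄ ()
parallel-vec⇒≡ d₂ d₁ ()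
parallel-vec⇒≡ d₂ d₂ _ = refl
parallel-vec⇒≡ d₂ d₃ ()
parallel-vec⇒≡ d₂ d₄ ()
parallel-vec⇒≡ d₃ d₁ ()
parallel-vec⇒≡ d₃ d₂ ()
parallel-vec⇒≡ d₃ d₃ _ = refl
parallel-vec⇒≡ d₃ d₄ ()
parallel-vec⇒≡ d₄ d₁ ()
parallel-vec⇒≡ d₄ d₂ ()
parallel-vec⇒≡ d₄ d₃ ()
parallel-vec⇒≡ d₄ d₄ _ = refl

collinear⇒parallel : ∀ p u w → Collinear p (p ⊕ u) (p ⊕ u ⊕ w) → Parallel u w
collinear⇒parallel (px , py) (a , b) (c , e) col =
  trans (sym (cong₂ _*_ ([i+j]-i≡j px a) ([i+j]-i≡j (py + b) e)))
        (trans col (cong₂ _*_ ([i+j]-i≡j py b) ([i+j]-i≡j (px + a) c)))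

collinear-resp-≡ : ∀ {p p′ q q′ r r′} → p ≡ p′ → q ≡ q′ → r ≡ r′ →
                   Collinear p q r → Collinear p′ q′ r′
collinear-resp-≡ refl refl refl col = col

collinear-reverse : ∀ p q r → Collinear p q r → Collinear r q p
collinear-reverse (px , py) (qx , qy) (rx , ry) col =
  trans (swap qx rx py qy) (trans (sym col) (swap qx px ry qy))
  where
  swap : ∀ a b c e → (a - b) * (c - e) ≡ (e - c) * (b - a)
  swap = solve-∀

continue-straight : ∀ d p q → KnightAdjacent (p ⊕ vec d) q → Collinear p (p ⊕ vec d) q →
                    q ≡ p ⊕ vec d ⊕ vec d ⊎ q ≡ p
continue-straight d p q adjacent col with adjacent
... | e , inj₁ refl rewrite parallel-vec⇒≡ d e (collinear⇒parallel p (vec d) (vec e) col) = inj₁ refl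
... | e , inj₂ refl rewrite parallel-vec⇒≡ d e (Parallel-negate (vec d) (vec e)
                              (collinear⇒parallel p (vec d) (negate (vec e)) col)) =
  inj₂ (⊕-⊖-cancel p (vec e))

vec-x-positive : ∀ d → ∃ λ m → proj₁ (vec d) ≡ + suc m
vec-x-positive d₁ = 0 , refl
vec-x-positive d₂ = 1 , refl
vec-x-positive d₃ = 1 , refl
vec-x-positive d₄ = 0 , refl

vec≢negate : ∀ d e → vec d ≢ negate (vec e)
vec≢negate d e eq with vec-x-positive d | vec-x-positive e
... | m , dx | m′ , ex with trans (sym dx) (trans (cong proj₁ eq) (cong -_ ex))
...   | ()

vec-injective : ∀ d e → vec d ≡ vec e → d ≡ e
vec-injective d e eq =
  parallel-vec⇒≡ d e (subst (Parallel (vec d)) eq (ℤP.*-comm (proj₁ (vec d)) (proj₂ (vec d))))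

negate-injective : ∀ u w → negate u ≡ negate w → u ≡ w
negate-injective u w eq =
  cong₂ _,_ (ℤP.neg-injective (cong proj₁ eq)) (ℤP.neg-injective (cong proj₂ eq))

along-unique : ∀ d e {p q} → Along (vec d) p q → Along (vec e) p q → d ≡ e
along-unique d e {p} (inj₁ refl) (inj₁ eq) = vec-injective d e (⊕-cancelˡ p eq)
along-unique d e {p} (inj₁ refl) (inj₂ eq) = ⊥-elim (vec≢negate d e (⊕-cancelˡ p eq))
along-unique d e {p} (inj₂ refl) (inj₁ eq) = ⊥-elim (vec≢negate e d (sym (⊕-cancelˡ p eq)))
along-unique d e {p} (inj₂ refl) (inj₂ eq) =
  vec-injective d e (negate-injective (vec d) (vec e) (⊕-cancelˡ p eq))

data DirPair : Set where
  d₁₂ d₁₃ d₁₄ d₂₃ d₂₄ d₃₄ : DirPair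

lo hi : DirPair → Dir
lo d₁₂ = d₁
lo d₁₃ = d₁
lo d₁₄ = d₁
lo d₂₃ = d₂
lo d₂₄ = d₂
lo d₃₄ = d₃
hi d₁₂ = d₂
hi d₁₃ = d₃
hi d₁₄ = d₄
hi d₂₃ = d₃
hi d₂₄ = d₄
hi d₃₄ = d₄

lo≢hi : ∀ τ → lo τ ≢ hi τ
lo≢hi d₁₂ ()
lo≢hi d₁₃ ()
lo≢hi d₁₄ ()
lo≢hi d₂₃ ()
lo≢hi d₂₄ ()
lo≢hi d₃₄ ()

Unordered : DirPair → Dir → Dir → Set
Unordered τ d d′ = (lo τ ≡ d × hi τ ≡ d′) ⊎ (lo τ ≡ d′ × hi τ ≡ d)

unordered-pair : ∀ d d′ → d ≢ d′ → ∃ λ τ → Unordered τ d d′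
unordered-pair d₁ d₁ d≢d′ = ⊥-elim (d≢d′ refl)
unordered-pair d₁ d₂ _ = d₁₂ , inj₁ (refl , refl)
unordered-pair d₁ d₃ _ = d₁₃ , inj₁ (refl , refl)
unordered-pair d₁ d₄ _ = d₁₄ , inj₁ (refl , refl)
unordered-pair d₂ d₁ _ = d₁₂ , inj₂ (refl , refl)
unordered-pair d₂ d₂ d≢d′ = ⊥-elim (d≢d′ refl)
unordered-pair d₂ d₃ _ = d₂₃ , inj₁ (refl , refl)
unordered-pair d₂ d₄ _ = d₂₄ , inj₁ (refl , refl)
unordered-pair d₃ d₁ _ = d₁₃ , inj₂ (refl , refl)
unordered-pair d₃ d₂ _ = d₂₃ , inj₂ (refl , refl)
unordered-pair d₃ d₃ d≢d′ = ⊥-elim (d≢d′ refl)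
unordered-pair d₃ d₄ _ = d₃₄ , inj₁ (refl , refl)
unordered-pair d₄ d₁ _ = d₁₄ , inj₂ (refl , refl)
unordered-pair d₄ d₂ _ = d₂₄ , inj₂ (refl , refl)
unordered-pair d₄ d₃ _ = d₃₄ , inj₂ (refl , refl)
unordered-pair d₄ d₄ d≢d′ = ⊥-elim (d≢d′ refl)

spacing : DirPair → ℕ
spacing d₁₂ = 3
spacing d₁₃ = 5
spacing d₁₄ = 4
spacing d₂₃ = 2
spacing d₂₄ = 5
spacing d₃₄ = 3

-- Walking straight along a ray

ray : Cell → ℤ × ℤ → ℤ → Cell
ray (x , y) (a , b) z = (x + z * a , y + z * b)

ray-zero : ∀ c v → ray c v (+ 0) ≡ c
ray-zero (x , y) (a , b) = cong₂ _,_ (ℤP.+-identityʳ x) (ℤP.+-identityʳ y)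

ray-suc : ∀ c v t → ray c v (+ suc t) ≡ ray c v (+ t) ⊕ v
ray-suc (x , y) (a , b) t = cong₂ _,_ (step x a (+ t)) (step y b (+ t))
  where
  step : ∀ x a z → x + (+ 1 + z) * a ≡ x + z * a + a
  step = solve-∀

collinear-ray : ∀ c v t → Collinear (ray c v (+ t)) (ray c v (+ suc t)) (ray c v (+ suc (suc t)))
collinear-ray (x , y) (a , b) t = equal-steps x y a b (+ t)
  where
  equal-steps : ∀ x y a b z →
    (x + (+ 1 + z) * a - (x + z * a)) * (y + (+ 1 + (+ 1 + z)) * b - (y + (+ 1 + z) * b)) ≡
    (y + (+ 1 + z) * b - (y + z * b)) * (x + (+ 1 + (+ 1 + z)) * a - (x + (+ 1 + z) * a))
  equal-steps = solve-∀

collinear? : ∀ p q r → Dec (Collinear p q r)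
collinear? (px , py) (qx , qy) (rx , ry) = (qx - px) * (ry - qy) ℤ.≟ (qy - py) * (rx - qx)

CollinearAt : (ℕ → Cell) → ℕ → Set
CollinearAt f j = Collinear (f j) (f (suc j)) (f (suc (suc j)))

module StraightLeg
  (f : ℕ → Cell) (c : Cell) (d : Dir) (Inside : ℕ → Set)
  (inside-antitone : ∀ t → Inside (suc t) → Inside t)
  (f0 : f 0 ≡ c) (f1 : f 1 ≡ c ⊕ vec d)
  (step : ∀ t → KnightAdjacent (f (suc t)) (f (suc (suc t))))
  (no-return : ∀ t → f (suc (suc t)) ≢ f t)
  (no-turn-inside : ∀ m → (∀ j → j ℕ.< m → CollinearAt f j) → ¬ CollinearAt f m →
                    Inside (suc m) → f (suc m) ≡ ray c (vec d) (+ suc m) → ⊥)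
  where

  follows-ray : ∀ t → Inside t → ∀ s → s ℕ.≤ suc t → f s ≡ ray c (vec d) (+ s)
  follows-ray zero _ zero _ = trans f0 (sym (ray-zero c (vec d)))
  follows-ray zero _ (suc zero) _ =
    trans f1 (sym (trans (ray-suc c (vec d) 0) (cong (_⊕ vec d) (ray-zero c (vec d)))))
  follows-ray zero _ (suc (suc s)) (s≤s ())
  follows-ray (suc t) inside s s≤2+t with ℕP.m≤n⇒m<n∨m≡n s≤2+t
  ... | inj₁ s<2+t = follows-ray t (inside-antitone t inside) s (ℕ.s≤s⁻¹ s<2+t)
  ... | inj₂ refl = next
    where
    D : ℤ × ℤ
    D = vec d
    on-ray : ∀ s → s ℕ.≤ suc t → f s ≡ ray c D (+ s)
    on-ray = follows-ray t (inside-antitone t inside)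
    straight : ∀ j → j ℕ.< t → CollinearAt f j
    straight j j<t = collinear-resp-≡ (sym (on-ray j (ℕP.m≤n⇒m≤1+n (ℕP.<⇒≤ j<t))))
                                      (sym (on-ray (suc j) (s≤s (ℕP.<⇒≤ j<t))))
                                      (sym (on-ray (suc (suc j)) (s≤s j<t)))
                                      (collinear-ray c D j)
    p : Cell
    p = ray c D (+ t)
    f[1+t] : f (suc t) ≡ p ⊕ D
    f[1+t] = trans (on-ray (suc t) ℕP.≤-refl) (ray-suc c D t)
    next : f (suc (suc t)) ≡ ray c D (+ suc (suc t))
    next with collinear? (f t) (f (suc t)) (f (suc (suc t)))
    ... | no turn = ⊥-elim (no-turn-inside t straight turn inside (on-ray (suc t) ℕP.≤-refl))
    ... | yes col
      with continue-straight d p (f (suc (suc t)))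
             (subst (λ q → KnightAdjacent q (f (suc (suc t)))) f[1+t] (step t))
             (collinear-resp-≡ {r = f (suc (suc t))} (on-ray t (ℕP.n≤1+n t)) f[1+t] refl col)
    ...   | inj₁ ahead = trans ahead (sym (trans (ray-suc c D (suc t)) (cong (_⊕ D) (ray-suc c D t))))
    ...   | inj₂ back = ⊥-elim (no-return t (trans back (sym (on-ray t (ℕP.n≤1+n t)))))

-- Closed tours

i+z+1≡i+[1+z] : ∀ i z → i + z + + 1 ≡ i + (+ 1 + z)
i+z+1≡i+[1+z] = solve-∀

i+z+2≡i+[2+z] : ∀ i z → i + z + + 2 ≡ i + (+ 1 + (+ 1 + z))
i+z+2≡i+[2+z] = solve-∀

i+[1+z]-1≡i+z : ∀ i z → i + (+ 1 + z) - + 1 ≡ i + z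
i+[1+z]-1≡i+z = solve-∀

i-[1+z]+1≡i-z : ∀ i z → i - (+ 1 + z) + + 1 ≡ i - z
i-[1+z]+1≡i-z = solve-∀

i-[2+z]+2≡i-z : ∀ i z → i - (+ 1 + (+ 1 + z)) + + 2 ≡ i - z
i-[2+z]+2≡i-z = solve-∀

i-z-1≡i-[1+z] : ∀ i z → i - z - + 1 ≡ i - (+ 1 + z)
i-z-1≡i-[1+z] = solve-∀

i-1+2≡i+1 : ∀ i → i - + 1 + + 2 ≡ i + + 1
i-1+2≡i+1 = solve-∀

module ClosedTourProperties {k : ℕ} (T : ClosedTour (2 ℕ.+ k)) where
  open ClosedTour T

  private
    N : ℕ
    N = (2 ℕ.+ k) ℕ.* (2 ℕ.+ k)

  cell-periodic-ℕ : ∀ m j → cell (j + + m * + N) ≡ cell j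
  cell-periodic-ℕ zero    j = cong cell (ℤP.+-identityʳ j)
  cell-periodic-ℕ (suc m) j =
    trans (cong cell (one-more j (+ m) (+ N))) (trans (periodic _) (cell-periodic-ℕ m j))
    where
    one-more : ∀ j z w → j + (+ 1 + z) * w ≡ j + z * w + w
    one-more = solve-∀

  cell-periodic : ∀ q j → cell (j + q * + N) ≡ cell j
  cell-periodic (+ m)    j = cell-periodic-ℕ m j
  cell-periodic -[1+ m ] j =
    trans (sym (cell-periodic-ℕ (suc m) _)) (cong cell (back-and-forth j (+ suc m) (+ N)))
    where
    back-and-forth : ∀ j a w → j + - a * w + a * w ≡ j
    back-and-forth = solve-∀

  cell≡⇒index≡ : ∀ {j j′} → cell j ≡ cell j′ → ∃ λ q → j ≡ j′ + q * + N
  cell≡⇒index≡ {j} {j′} cj≡cj′ = j /ℕ N - j′ /ℕ N , ≡-mod⇒≡+multiple N j′ j (ℤP.+-injective (sym r≡r′))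
    where
    reduce : ∀ i → cell (+ (i %ℕ N)) ≡ cell i
    reduce i = trans (sym (cell-periodic (i /ℕ N) _)) (cong cell (sym (a≡a%ℕn+[a/ℕn]*n i N)))
    r≡r′ : + (j %ℕ N) ≡ + (j′ %ℕ N)
    r≡r′ = inj _ _ (+≤+ z≤n) (+<+ (n%ℕd<d j N)) (+≤+ z≤n) (+<+ (n%ℕd<d j′ N))
                   (trans (reduce j) (trans cj≡cj′ (sym (reduce j′))))

  cell-shift : ∀ {j j′} → cell j ≡ cell j′ → ∀ m → cell (j + m) ≡ cell (j′ + m)
  cell-shift {j′ = j′} cj≡cj′ m with cell≡⇒index≡ cj≡cj′
  ... | q , refl = trans (cong cell (reorder j′ q (+ N) m)) (cell-periodic q (j′ + m))
    where
    reorder : ∀ j q w m → j + q * w + m ≡ j + m + q * w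
    reorder = solve-∀

  cell[j+2]≢cell[j] : ∀ j → cell (j + + 2) ≢ cell j
  cell[j+2]≢cell[j] j eq with cell≡⇒index≡ eq
  ... | q , j+2≡j+qN = 2≢a*N ∣ q ∣ (trans (cong ∣_∣ (∙-cancelˡ j _ _ j+2≡j+qN)) (ℤP.abs-* q (+ N)))
    where
    4≤N : 4 ℕ.≤ N
    4≤N = ℕP.*-mono-≤ {2} {2 ℕ.+ k} {2} {2 ℕ.+ k} (s≤s (s≤s z≤n)) (s≤s (s≤s z≤n))
    2≢a*N : ∀ a → 2 ≢ a ℕ.* N
    2≢a*N zero    ()
    2≢a*N (suc a) 2≡ with subst (4 ℕ.≤_) (sym 2≡) (ℕP.≤-trans 4≤N (ℕP.m≤m+n N (a ℕ.* N)))
    ... | s≤s (s≤s ())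

  exit-directions : ∀ {i y} → cell i ≡ (+ 0 , y) →
                    ∃ λ d → ∃ λ d′ → d ≢ d′ × cell (i + + 1) ≡ (+ 0 , y) ⊕ vec d
                                           × cell (i - + 1) ≡ (+ 0 , y) ⊕ vec d′
  exit-directions {i} {y} cᵢ = d , d′ , d≢d′ , proj₂ next , proj₂ prev
    where
    next : ∃ λ d → cell (i + + 1) ≡ (+ 0 , y) ⊕ vec d
    next = rightward-move y (cell (i + + 1))
             (subst (λ p → KnightAdjacent p (cell (i + + 1))) cᵢ
                    (knightMove⇒adjacent _ _ (knight i)))
             (proj₁ (proj₁ (onBoard _)))
    prev : ∃ λ d → cell (i - + 1) ≡ (+ 0 , y) ⊕ vec d
    prev = rightward-move y (cell (i - + 1))
             (KnightAdjacent-sym {cell (i - + 1)} {+ 0 , y}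
               (subst (KnightAdjacent (cell (i - + 1)))
                      (trans (cong cell (trans (i-[1+z]+1≡i-z i (+ 0)) (ℤP.+-identityʳ i))) cᵢ)
                      (knightMove⇒adjacent _ _ (knight (i - + 1)))))
             (proj₁ (proj₁ (onBoard _)))
    d d′ : Dir
    d = proj₁ next
    d′ = proj₁ prev
    d≢d′ : d ≢ d′
    d≢d′ d≡d′ = cell[j+2]≢cell[j] (i - + 1)
      (trans (cong cell (i-1+2≡i+1 i))
             (trans (proj₂ next) (trans (cong (λ e → (+ 0 , y) ⊕ vec e) d≡d′) (sym (proj₂ prev)))))

  StraightThrough : Cell → Dir → Set
  StraightThrough p d = ∃ λ j → cell j ≡ p × Along (vec d) p (cell (j + + 1))

  straightThrough-unique : ∀ {p d e} → StraightThrough p d → StraightThrough p e → d ≡ e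
  straightThrough-unique {p} {d} {e} (j , cj , along) (j′ , cj′ , along′) =
    along-unique d e {p} along
      (subst (Along (vec e) p) (sym (cell-shift (trans cj (sym cj′)) (+ 1))) along′)

-- The crown

module Crown (ya yb : ℤ) where

  InCrownRegion : Cell → Set
  InCrownRegion p = InS ya D₂ yb D₁ p ⊎ InS ya D₃ yb D₂ p ⊎ InS ya D₄ yb D₃ p

  -- Linear conditions for the z-th cell of the ray from (0 , y) along d to lie in the crown;
  -- rays along D₂ and D₃ cross two of its three regions S.
  WithinCrown : Dir → ℤ → ℤ → Set
  WithinCrown d₁ y z = + 3 * z ≤ + 2 * (ya - y)
  WithinCrown d₂ y z = + 3 * z ≤ y - yb ⊎ + 2 * z ≤ ya - y
  WithinCrown d₃ y z = + 2 * z ≤ y - yb ⊎ + 3 * z ≤ ya - y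
  WithinCrown d₄ y z = + 3 * z ≤ + 2 * (y - yb)

  withinCrown-antitone : ∀ d y {z z′} → z′ ≤ z → WithinCrown d y z → WithinCrown d y z′
  withinCrown-antitone d₁ y z′≤z h       = ℤP.≤-trans (ℤP.*-monoˡ-≤-nonNeg (+ 3) z′≤z) h
  withinCrown-antitone d₂ y z′≤z (inj₁ h) = inj₁ (ℤP.≤-trans (ℤP.*-monoˡ-≤-nonNeg (+ 3) z′≤z) h)
  withinCrown-antitone d₂ y z′≤z (inj₂ h) = inj₂ (ℤP.≤-trans (ℤP.*-monoˡ-≤-nonNeg (+ 2) z′≤z) h)
  withinCrown-antitone d₃ y z′≤z (inj₁ h) = inj₁ (ℤP.≤-trans (ℤP.*-monoˡ-≤-nonNeg (+ 2) z′≤z) h)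
  withinCrown-antitone d₃ y z′≤z (inj₂ h) = inj₂ (ℤP.≤-trans (ℤP.*-monoˡ-≤-nonNeg (+ 3) z′≤z) h)
  withinCrown-antitone d₄ y z′≤z h       = ℤP.≤-trans (ℤP.*-monoˡ-≤-nonNeg (+ 3) z′≤z) h

  ray-x-nonneg : ∀ a {z} → + 0 ≤ z → + 0 ≤ + 0 + z * + a
  ray-x-nonneg a 0≤z = ℤP.+-mono-≤ (+≤+ z≤n) (ℤP.*-monoʳ-≤-nonNeg (+ a) 0≤z)

  withinCrown⇒inCrownRegion : ∀ d y z → yb ≤ y → y ≤ ya → + 0 ≤ z → WithinCrown d y z →
                              InCrownRegion (ray (+ 0 , y) (vec d) z)
  withinCrown⇒inCrownRegion d₁ y z yb≤y y≤ya 0≤z h =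
    inj₁ (ray-x-nonneg 1 0≤z , below , above)
    where
    below : + 2 * (y + z * + 2 - ya) ≤ + 1 * (+ 0 + z * + 1)
    below = ≤-byGap 1 h (solve (y ∷ ya ∷ z ∷ []))
    above : + 2 * (+ 0 + z * + 1) ≤ + 1 * (y + z * + 2 - yb)
    above = ≤-byGap 1 yb≤y (solve (y ∷ yb ∷ z ∷ []))
  withinCrown⇒inCrownRegion d₂ y z yb≤y y≤ya 0≤z (inj₁ h) =
    inj₁ (ray-x-nonneg 2 0≤z , below , above)
    where
    below : + 2 * (y + z * + 1 - ya) ≤ + 1 * (+ 0 + z * + 2)
    below = ≤-byGap 2 y≤ya (solve (y ∷ ya ∷ z ∷ []))
    above : + 2 * (+ 0 + z * + 2) ≤ + 1 * (y + z * + 1 - yb)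
    above = ≤-byGap 1 h (solve (y ∷ yb ∷ z ∷ []))
  withinCrown⇒inCrownRegion d₂ y z yb≤y y≤ya 0≤z (inj₂ h) =
    inj₂ (inj₁ (ray-x-nonneg 2 0≤z , below , above))
    where
    below : + 2 * (y + z * + 1 - ya) ≤ -[1+ 0 ] * (+ 0 + z * + 2)
    below = ≤-byGap 2 h (solve (y ∷ ya ∷ z ∷ []))
    above : + 1 * (+ 0 + z * + 2) ≤ + 2 * (y + z * + 1 - yb)
    above = ≤-byGap 2 yb≤y (solve (y ∷ yb ∷ z ∷ []))
  withinCrown⇒inCrownRegion d₃ y z yb≤y y≤ya 0≤z (inj₁ h) =
    inj₂ (inj₁ (ray-x-nonneg 2 0≤z , below , above))
    where
    below : + 2 * (y + z * -[1+ 0 ] - ya) ≤ -[1+ 0 ] * (+ 0 + z * + 2)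
    below = ≤-byGap 2 y≤ya (solve (y ∷ ya ∷ z ∷ []))
    above : + 1 * (+ 0 + z * + 2) ≤ + 2 * (y + z * -[1+ 0 ] - yb)
    above = ≤-byGap 2 h (solve (y ∷ yb ∷ z ∷ []))
  withinCrown⇒inCrownRegion d₃ y z yb≤y y≤ya 0≤z (inj₂ h) =
    inj₂ (inj₂ (ray-x-nonneg 2 0≤z , below , above))
    where
    below : + 1 * (y + z * -[1+ 0 ] - ya) ≤ -[1+ 1 ] * (+ 0 + z * + 2)
    below = ≤-byGap 1 h (solve (y ∷ ya ∷ z ∷ []))
    above : -[1+ 0 ] * (+ 0 + z * + 2) ≤ + 2 * (y + z * -[1+ 0 ] - yb)
    above = ≤-byGap 2 yb≤y (solve (y ∷ yb ∷ z ∷ []))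
  withinCrown⇒inCrownRegion d₄ y z yb≤y y≤ya 0≤z h =
    inj₂ (inj₂ (ray-x-nonneg 1 0≤z , below , above))
    where
    below : + 1 * (y + z * -[1+ 1 ] - ya) ≤ -[1+ 1 ] * (+ 0 + z * + 1)
    below = ≤-byGap 1 y≤ya (solve (y ∷ ya ∷ z ∷ []))
    above : -[1+ 0 ] * (+ 0 + z * + 1) ≤ + 2 * (y + z * -[1+ 1 ] - yb)
    above = ≤-byGap 1 h (solve (y ∷ yb ∷ z ∷ []))

  record RaysMeet (y y′ : ℤ) (d d′ : Dir) : Set where
    field
      z z′    : ℤ
      0<z     : + 0 < z
      0<z′    : + 0 < z′
      meet    : ray (+ 0 , y) (vec d) z ≡ ray (+ 0 , y′) (vec d′) z′
      within  : WithinCrown d y z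
      within′ : WithinCrown d′ y′ z′

  rays-meet : ∀ τ y σ → + 0 < σ → yb ≤ y → y + σ * + spacing τ ≤ ya →
              RaysMeet y (y + σ * + spacing τ) (lo τ) (hi τ)
  rays-meet d₁₂ y σ 0<σ yb≤y y′≤ya = record
    { z = σ + σ ; z′ = σ ; 0<z = ℤP.+-mono-< 0<σ 0<σ ; 0<z′ = 0<σ
    ; meet = meet ; within = within ; within′ = inj₁ within′ }
    where
    meet : (+ 0 + (σ + σ) * + 1 , y + (σ + σ) * + 2) ≡ (+ 0 + σ * + 2 , y + σ * + 3 + σ * + 1)
    meet = cong₂ _,_ (solve (σ ∷ [])) (solve (y ∷ σ ∷ []))
    within : + 3 * (σ + σ) ≤ + 2 * (ya - y)
    within = ≤-byGap 2 y′≤ya (solve (y ∷ ya ∷ σ ∷ []))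
    within′ : + 3 * σ ≤ y + σ * + 3 - yb
    within′ = ≤-byGap 1 yb≤y (solve (y ∷ yb ∷ σ ∷ []))
  rays-meet d₁₃ y σ 0<σ yb≤y y′≤ya = record
    { z = σ + σ ; z′ = σ ; 0<z = ℤP.+-mono-< 0<σ 0<σ ; 0<z′ = 0<σ
    ; meet = meet ; within = within ; within′ = inj₁ within′ }
    where
    meet : (+ 0 + (σ + σ) * + 1 , y + (σ + σ) * + 2) ≡ (+ 0 + σ * + 2 , y + σ * + 5 + σ * -[1+ 0 ])
    meet = cong₂ _,_ (solve (σ ∷ [])) (solve (y ∷ σ ∷ []))
    within : + 3 * (σ + σ) ≤ + 2 * (ya - y)
    within = ≤-byGap₂ 2 4 y′≤ya (ℤP.<⇒≤ 0<σ) (solve (y ∷ ya ∷ σ ∷ []))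
    within′ : + 2 * σ ≤ y + σ * + 5 - yb
    within′ = ≤-byGap₂ 1 3 yb≤y (ℤP.<⇒≤ 0<σ) (solve (y ∷ yb ∷ σ ∷ []))
  rays-meet d₁₄ y σ 0<σ yb≤y y′≤ya = record
    { z = σ ; z′ = σ ; 0<z = 0<σ ; 0<z′ = 0<σ
    ; meet = meet ; within = within ; within′ = within′ }
    where
    meet : (+ 0 + σ * + 1 , y + σ * + 2) ≡ (+ 0 + σ * + 1 , y + σ * + 4 + σ * -[1+ 1 ])
    meet = cong₂ _,_ refl (solve (y ∷ σ ∷ []))
    within : + 3 * σ ≤ + 2 * (ya - y)
    within = ≤-byGap₂ 2 5 y′≤ya (ℤP.<⇒≤ 0<σ) (solve (y ∷ ya ∷ σ ∷ []))
    within′ : + 3 * σ ≤ + 2 * (y + σ * + 4 - yb)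
    within′ = ≤-byGap₂ 2 5 yb≤y (ℤP.<⇒≤ 0<σ) (solve (y ∷ yb ∷ σ ∷ []))
  rays-meet d₂₃ y σ 0<σ yb≤y y′≤ya = record
    { z = σ ; z′ = σ ; 0<z = 0<σ ; 0<z′ = 0<σ
    ; meet = meet ; within = inj₂ within ; within′ = inj₁ within′ }
    where
    meet : (+ 0 + σ * + 2 , y + σ * + 1) ≡ (+ 0 + σ * + 2 , y + σ * + 2 + σ * -[1+ 0 ])
    meet = cong₂ _,_ refl (solve (y ∷ σ ∷ []))
    within : + 2 * σ ≤ ya - y
    within = ≤-byGap 1 y′≤ya (solve (y ∷ ya ∷ σ ∷ []))
    within′ : + 2 * σ ≤ y + σ * + 2 - yb
    within′ = ≤-byGap 1 yb≤y (solve (y ∷ yb ∷ σ ∷ []))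
  rays-meet d₂₄ y σ 0<σ yb≤y y′≤ya = record
    { z = σ ; z′ = σ + σ ; 0<z = 0<σ ; 0<z′ = ℤP.+-mono-< 0<σ 0<σ
    ; meet = meet ; within = inj₂ within ; within′ = within′ }
    where
    meet : (+ 0 + σ * + 2 , y + σ * + 1) ≡ (+ 0 + (σ + σ) * + 1 , y + σ * + 5 + (σ + σ) * -[1+ 1 ])
    meet = cong₂ _,_ (solve (σ ∷ [])) (solve (y ∷ σ ∷ []))
    within : + 2 * σ ≤ ya - y
    within = ≤-byGap₂ 1 3 y′≤ya (ℤP.<⇒≤ 0<σ) (solve (y ∷ ya ∷ σ ∷ []))
    within′ : + 3 * (σ + σ) ≤ + 2 * (y + σ * + 5 - yb)
    within′ = ≤-byGap₂ 2 4 yb≤y (ℤP.<⇒≤ 0<σ) (solve (y ∷ yb ∷ σ ∷ []))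
  rays-meet d₃₄ y σ 0<σ yb≤y y′≤ya = record
    { z = σ ; z′ = σ + σ ; 0<z = 0<σ ; 0<z′ = ℤP.+-mono-< 0<σ 0<σ
    ; meet = meet ; within = inj₂ within ; within′ = within′ }
    where
    meet : (+ 0 + σ * + 2 , y + σ * -[1+ 0 ]) ≡
           (+ 0 + (σ + σ) * + 1 , y + σ * + 3 + (σ + σ) * -[1+ 1 ])
    meet = cong₂ _,_ (solve (σ ∷ [])) (solve (y ∷ σ ∷ []))
    within : + 3 * σ ≤ ya - y
    within = ≤-byGap 1 y′≤ya (solve (y ∷ ya ∷ σ ∷ []))
    within′ : + 3 * (σ + σ) ≤ + 2 * (y + σ * + 3 - yb)
    within′ = ≤-byGap 2 yb≤y (solve (y ∷ yb ∷ σ ∷ []))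

-- Clean cells

instance
  spacing-nonZero : ∀ {τ} → ℕ.NonZero (spacing τ)
  spacing-nonZero {d₁₂} = _
  spacing-nonZero {d₁₃} = _
  spacing-nonZero {d₁₄} = _
  spacing-nonZero {d₂₃} = _
  spacing-nonZero {d₂₄} = _
  spacing-nonZero {d₃₄} = _

spacing≤5 : ∀ τ → spacing τ ℕ.≤ 5
spacing≤5 d₁₂ = ℕP.m≤m+n 3 2
spacing≤5 d₁₃ = ℕP.≤-refl
spacing≤5 d₁₄ = ℕP.m≤m+n 4 1
spacing≤5 d₂₃ = ℕP.m≤m+n 2 3
spacing≤5 d₂₄ = ℕP.≤-refl
spacing≤5 d₃₄ = ℕP.m≤m+n 3 2

dirPairs : Vec DirPair 6
dirPairs = Vec.fromList (d₁₂ ∷ d₁₃ ∷ d₁₄ ∷ d₂₃ ∷ d₂₄ ∷ d₃₄ ∷ [])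

dirPair-index : DirPair → Fin 6
dirPair-index d₁₂ = # 0
dirPair-index d₁₃ = # 1
dirPair-index d₁₄ = # 2
dirPair-index d₂₃ = # 3
dirPair-index d₂₄ = # 4
dirPair-index d₃₄ = # 5

lookup-dirPair-index : ∀ τ → Vec.lookup dirPairs (dirPair-index τ) ≡ τ
lookup-dirPair-index d₁₂ = refl
lookup-dirPair-index d₁₃ = refl
lookup-dirPair-index d₁₄ = refl
lookup-dirPair-index d₂₃ = refl
lookup-dirPair-index d₂₄ = refl
lookup-dirPair-index d₃₄ = refl

dirPair-index-injective : ∀ τ τ′ → dirPair-index τ ≡ dirPair-index τ′ → τ ≡ τ′
dirPair-index-injective τ τ′ eq =
  trans (sym (lookup-dirPair-index τ))
        (trans (cong (Vec.lookup dirPairs) eq) (lookup-dirPair-index τ′))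

module CleanCells {k : ℕ} (T : ClosedTour (2 ℕ.+ k)) (ya yb : ℤ) where
  open ClosedTour T
  open ClosedTourProperties T
  open Crown ya yb

  private
    n : ℕ
    n = 2 ℕ.+ k

  forward-legEnd : ∀ i m → (∀ j → j ℕ.< m → CollinearAt (λ s → cell (i + + s)) j) →
                   ¬ CollinearAt (λ s → cell (i + + s)) m → ForwardLegEnd T i (suc m)
  forward-legEnd i m straight turn = s≤s z≤n , no-turn , λ col → turn (from-turn m col)
    where
    to-turn : ∀ j → CollinearAt (λ s → cell (i + + s)) j →
              Collinear (cell (i + + suc j - + 1)) (cell (i + + suc j)) (cell (i + + suc j + + 1))
    to-turn j = collinear-resp-≡ {q = cell (i + + suc j)}
                  (cong cell (sym (i+[1+z]-1≡i+z i (+ j)))) refl (cong cell (sym (i+z+1≡i+[1+z] i (+ suc j))))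
    from-turn : ∀ j →
                Collinear (cell (i + + suc j - + 1)) (cell (i + + suc j)) (cell (i + + suc j + + 1)) →
                CollinearAt (λ s → cell (i + + s)) j
    from-turn j = collinear-resp-≡ {q = cell (i + + suc j)}
                    (cong cell (i+[1+z]-1≡i+z i (+ j))) refl (cong cell (i+z+1≡i+[1+z] i (+ suc j)))
    no-turn : ∀ j → 1 ℕ.≤ j → j ℕ.< suc m → ¬ TurnAt T (i + + j)
    no-turn (suc j) _ j<m turn = turn (to-turn j (straight j (ℕ.s≤s⁻¹ j<m)))

  backward-legEnd : ∀ i m → (∀ j → j ℕ.< m → CollinearAt (λ s → cell (i - + s)) j) →
                    ¬ CollinearAt (λ s → cell (i - + s)) m → BackwardLegEnd T i (suc m)
  backward-legEnd i m straight turn = s≤s z≤n , no-turn , λ col → turn (from-turn m col)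
    where
    to-turn : ∀ j → CollinearAt (λ s → cell (i - + s)) j →
              Collinear (cell (i - + suc j - + 1)) (cell (i - + suc j)) (cell (i - + suc j + + 1))
    to-turn j col =
      collinear-resp-≡ {q = cell (i - + suc j)}
        (cong cell (sym (i-z-1≡i-[1+z] i (+ suc j)))) refl (cong cell (sym (i-[1+z]+1≡i-z i (+ j))))
        (collinear-reverse (cell (i - + j)) (cell (i - + suc j)) (cell (i - + suc (suc j))) col)
    from-turn : ∀ j →
                Collinear (cell (i - + suc j - + 1)) (cell (i - + suc j)) (cell (i - + suc j + + 1)) →
                CollinearAt (λ s → cell (i - + s)) j
    from-turn j col =
      collinear-reverse (cell (i - + suc (suc j))) (cell (i - + suc j)) (cell (i - + j))
        (collinear-resp-≡ {q = cell (i - + suc j)}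
           (cong cell (i-z-1≡i-[1+z] i (+ suc j))) refl (cong cell (i-[1+z]+1≡i-z i (+ j))) col)
    no-turn : ∀ j → 1 ℕ.≤ j → j ℕ.< suc m → ¬ TurnAt T (i - + j)
    no-turn (suc j) _ j<m turn = turn (to-turn j (straight j (ℕ.s≤s⁻¹ j<m)))

  leg-follows-ray : ∀ (f : ℕ → Cell) y d → yb ≤ y → y ≤ ya →
    f 0 ≡ (+ 0 , y) → f 1 ≡ (+ 0 , y) ⊕ vec d →
    (∀ t → KnightAdjacent (f (suc t)) (f (suc (suc t)))) → (∀ t → f (suc (suc t)) ≢ f t) →
    (∀ s → OnBoard n (f s)) →
    (∀ m → (∀ j → j ℕ.< m → CollinearAt f j) → ¬ CollinearAt f m → ¬ InCrown n ya yb (f (suc m))) →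
    ∀ t → WithinCrown d y (+ t) → ∀ s → s ℕ.≤ suc t → f s ≡ ray (+ 0 , y) (vec d) (+ s)
  leg-follows-ray f y d yb≤y y≤ya f0 f1 step no-return on-board ends-outside =
    StraightLeg.follows-ray f (+ 0 , y) d (λ t → WithinCrown d y (+ t))
      (λ t → withinCrown-antitone d y (+≤+ (ℕP.n≤1+n t))) f0 f1 step no-return turn-outside
    where
    turn-outside : ∀ m → (∀ j → j ℕ.< m → CollinearAt f j) → ¬ CollinearAt f m →
                   WithinCrown d y (+ suc m) → f (suc m) ≡ ray (+ 0 , y) (vec d) (+ suc m) → ⊥
    turn-outside m straight turn within on-ray = ends-outside m straight turn
      ( on-board (suc m)
      , subst InCrownRegion (sym on-ray)
              (withinCrown⇒inCrownRegion d y (+ suc m) yb≤y y≤ya (+≤+ z≤n) within))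

  RunsAlong : ℤ → Dir → Set
  RunsAlong y d = ∀ z → + 0 < z → WithinCrown d y z → StraightThrough (ray (+ 0 , y) (vec d) z) d

  forward-run : ∀ {i y d} → yb ≤ y → y ≤ ya →
                cell i ≡ (+ 0 , y) → cell (i + + 1) ≡ (+ 0 , y) ⊕ vec d →
                (∀ m → ForwardLegEnd T i m → ¬ InCrown n ya yb (cell (i + + m))) → RunsAlong y d
  forward-run {i} {y} {d} yb≤y y≤ya cᵢ cᵢ₊₁ clean (+ suc t) _ within =
    i + + suc t , on-ray (suc t) (ℕP.n≤1+n _) ,
    inj₁ (trans (cong cell (i+z+1≡i+[1+z] i (+ suc t)))
                (trans (on-ray (suc (suc t)) ℕP.≤-refl) (ray-suc (+ 0 , y) (vec d) (suc t))))
    where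
    f : ℕ → Cell
    f s = cell (i + + s)
    step : ∀ t → KnightAdjacent (f (suc t)) (f (suc (suc t)))
    step t = knightMove⇒adjacent _ _
      (subst (λ j → KnightMove (f (suc t)) (cell j)) (i+z+1≡i+[1+z] i (+ suc t)) (knight _))
    no-return : ∀ t → f (suc (suc t)) ≢ f t
    no-return t eq = cell[j+2]≢cell[j] (i + + t) (trans (cong cell (i+z+2≡i+[2+z] i (+ t))) eq)
    on-ray : ∀ s → s ℕ.≤ suc (suc t) → f s ≡ ray (+ 0 , y) (vec d) (+ s)
    on-ray = leg-follows-ray f y d yb≤y y≤ya (trans (cong cell (ℤP.+-identityʳ i)) cᵢ) cᵢ₊₁
               step no-return (λ s → onBoard _)
               (λ m straight turn → clean (suc m) (forward-legEnd i m straight turn))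
               (suc t) within
  forward-run _ _ _ _ _ (+ zero)   (+<+ ())
  forward-run _ _ _ _ _ -[1+ _ ]   ()

  backward-run : ∀ {i y d} → yb ≤ y → y ≤ ya →
                 cell i ≡ (+ 0 , y) → cell (i - + 1) ≡ (+ 0 , y) ⊕ vec d →
                 (∀ m → BackwardLegEnd T i m → ¬ InCrown n ya yb (cell (i - + m))) → RunsAlong y d
  backward-run {i} {y} {d} yb≤y y≤ya cᵢ cᵢ₋₁ clean (+ suc t) _ within =
    i - + suc t , on-ray (suc t) (ℕP.n≤1+n _) ,
    inj₂ (trans (cong cell (i-[1+z]+1≡i-z i (+ t)))
                (trans (on-ray t (ℕP.m≤n⇒m≤1+n (ℕP.n≤1+n t)))
                       (trans (sym (⊕-⊖-cancel (ray (+ 0 , y) (vec d) (+ t)) (vec d)))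
                              (cong (_⊖ vec d) (sym (ray-suc (+ 0 , y) (vec d) t))))))
    where
    f : ℕ → Cell
    f s = cell (i - + s)
    step : ∀ t → KnightAdjacent (f (suc t)) (f (suc (suc t)))
    step t = KnightAdjacent-sym {f (suc (suc t))} {f (suc t)} (knightMove⇒adjacent _ _
      (subst (λ j → KnightMove (f (suc (suc t))) (cell j)) (i-[1+z]+1≡i-z i (+ suc t)) (knight _)))
    no-return : ∀ t → f (suc (suc t)) ≢ f t
    no-return t eq =
      cell[j+2]≢cell[j] (i - + suc (suc t)) (trans (cong cell (i-[2+z]+2≡i-z i (+ t))) (sym eq))
    on-ray : ∀ s → s ℕ.≤ suc (suc t) → f s ≡ ray (+ 0 , y) (vec d) (+ s)
    on-ray = leg-follows-ray f y d yb≤y y≤ya (trans (cong cell (ℤP.+-identityʳ i)) cᵢ) cᵢ₋₁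
               step no-return (λ s → onBoard _)
               (λ m straight turn → clean (suc m) (backward-legEnd i m straight turn))
               (suc t) within
  backward-run _ _ _ _ _ (+ zero)   (+<+ ())
  backward-run _ _ _ _ _ -[1+ _ ]   ()

  record CleanProfile (y : ℤ) : Set where
    field
      yb≤y    : yb ≤ y
      y≤ya    : y ≤ ya
      type    : DirPair
      runs-lo : RunsAlong y (lo type)
      runs-hi : RunsAlong y (hi type)

  clean⇒profile : + 0 ≤ yb → ya < + n → ∀ y →
                  (yb ≤ y × y ≤ ya) × Clean T ya yb (+ 0 , y) → CleanProfile y
  clean⇒profile 0≤yb ya<n y ((yb≤y , y≤ya) , clean)
    with surj (+ 0 , y) ((+≤+ z≤n , +<+ (s≤s z≤n)) , ℤP.≤-trans 0≤yb yb≤y , ℤP.≤-<-trans y≤ya ya<n)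
  ... | i , cᵢ with exit-directions cᵢ
  ... | d , d′ , d≢d′ , cᵢ₊₁ , cᵢ₋₁ = profile (unordered-pair d d′ d≢d′)
    where
    runs : RunsAlong y d
    runs = forward-run yb≤y y≤ya cᵢ cᵢ₊₁ (proj₁ (clean i cᵢ))
    runs′ : RunsAlong y d′
    runs′ = backward-run yb≤y y≤ya cᵢ cᵢ₋₁ (proj₂ (clean i cᵢ))
    profile : ∃ (λ τ → Unordered τ d d′) → CleanProfile y
    profile (τ , inj₁ (lo≡d , hi≡d′)) = record
      { yb≤y = yb≤y ; y≤ya = y≤ya ; type = τ
      ; runs-lo = subst (RunsAlong y) (sym lo≡d) runs
      ; runs-hi = subst (RunsAlong y) (sym hi≡d′) runs′ }
    profile (τ , inj₂ (lo≡d′ , hi≡d)) = record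
      { yb≤y = yb≤y ; y≤ya = y≤ya ; type = τ
      ; runs-lo = subst (RunsAlong y) (sym lo≡d′) runs′
      ; runs-hi = subst (RunsAlong y) (sym hi≡d) runs }

  open CleanProfile

  no-collision : ∀ {y y′} (P : CleanProfile y) (P′ : CleanProfile y′) → type P′ ≡ type P →
                 ∀ σ → + 0 < σ → y′ ≡ y + σ * + spacing (type P) → ⊥
  no-collision {y} P P′ same-type σ 0<σ refl =
    lo≢hi τ (straightThrough-unique {ray (+ 0 , y) (vec (lo τ)) z} lo-pass
              (subst (λ p → StraightThrough p (hi τ)) (sym meet) hi-pass))
    where
    τ : DirPair
    τ = type P
    open RaysMeet (rays-meet τ y σ 0<σ (yb≤y P) (y≤ya P′))
    lo-pass : StraightThrough (ray (+ 0 , y) (vec (lo τ)) z) (lo τ)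
    lo-pass = runs-lo P z 0<z within
    hi-pass : StraightThrough (ray (+ 0 , y + σ * + spacing τ) (vec (hi τ)) z′) (hi τ)
    hi-pass = subst (λ τ′ → RunsAlong _ (hi τ′)) same-type (runs-hi P′) z′ 0<z′ within′

  residue : DirPair → ℤ → Fin 5
  residue τ y = fromℕ< (ℕP.<-≤-trans (n%ℕd<d y (spacing τ)) (spacing≤5 τ))

  code : ∀ {y} → CleanProfile y → Fin (6 ℕ.* 5)
  code {y} P = combine (dirPair-index (type P)) (residue (type P) y)

  lower-code≢ : ∀ {y y′} (P : CleanProfile y) (P′ : CleanProfile y′) → y < y′ → code P ≢ code P′
  lower-code≢ {y} {y′} P P′ y<y′ same-code with FinP.combine-injective _ _ _ _ same-code
  ... | same-index , same-residue = no-collision P P′ (sym same-type) σ 0<σ y′≡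
    where
    same-type : type P ≡ type P′
    same-type = dirPair-index-injective _ _ same-index
    m : ℕ
    m = spacing (type P)
    y%m≡y′%m : y %ℕ m ≡ y′ %ℕ m
    y%m≡y′%m = trans (sym (FinP.toℕ-fromℕ< _))
                 (trans (cong toℕ (trans same-residue (cong (λ τ → residue τ y′) (sym same-type))))
                        (FinP.toℕ-fromℕ< _))
    σ : ℤ
    σ = y′ /ℕ m - y /ℕ m
    y′≡ : y′ ≡ y + σ * + m
    y′≡ = ≡-mod⇒≡+multiple m y y′ y%m≡y′%m
    0<σ : + 0 < σ
    0<σ = ℤP.*-cancelʳ-<-nonNeg (+ m) (i<i+j⇒0<j y (σ * + m) (subst (y <_) y′≡ y<y′))

  code-injective : ∀ {y y′} (P : CleanProfile y) (P′ : CleanProfile y′) → code P ≡ code P′ → y ≡ y′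
  code-injective {y} {y′} P P′ same-code with ℤP.<-cmp y y′
  ... | tri< y<y′ _ _ = ⊥-elim (lower-code≢ P P′ y<y′ same-code)
  ... | tri≈ _ y≡y′ _ = y≡y′
  ... | tri> _ _ y′<y = ⊥-elim (lower-code≢ P′ P y′<y (sym same-code))

board-size≥2 : ∀ {n ya yb} → + 0 ≤ yb → yb < ya → ya < + n → 2 ℕ.≤ n
board-size≥2 0≤yb yb<ya ya<n =
  ℤP.drop‿+≤+ (ℤP.i<j⇒suc[i]≤j (ℤP.≤-<-trans (ℤP.i<j⇒suc[i]≤j (ℤP.≤-<-trans 0≤yb yb<ya)) ya<n))

mainTheorem2 : (n : ℕ) (T : ClosedTour n) (ya yb : ℤ) →
    + 0 ≤ yb → yb < ya → ya < + n →
    (ys : List ℤ) → Unique ys →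
    All (λ y → (yb ≤ y × y ≤ ya) × Clean T ya yb (+ 0 , y)) ys →
    length ys ℕ.≤ 122
mainTheorem2 0 _ _ _ 0≤yb yb<ya ya<n _ _ _ with board-size≥2 0≤yb yb<ya ya<n
... | ()
mainTheorem2 1 _ _ _ 0≤yb yb<ya ya<n _ _ _ with board-size≥2 0≤yb yb<ya ya<n
... | s≤s ()
mainTheorem2 (suc (suc k)) T ya yb 0≤yb _ ya<n ys unique clean =
  ℕP.≤-trans (length≤-byInjectiveCode 30 code code-injective unique
                (All.map (λ {y} → clean⇒profile 0≤yb ya<n y) clean))
             (ℕP.m≤m+n 30 92)
  where open CleanCells T ya yb
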